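{- Let $h\ge 2$, $w=2h+1$, and let $n\in A_w$ have parameters $p(n)=(\alpha^1,\dots,\alpha^h)$ satisfying $5<\alpha^1$, $\alpha^1\ge\alpha^2+1$, $5\le\alpha^s\le 8$ for $2\le s\le h$, and $\alpha^s+\alpha^{s+1}\ge 9$ for $1\le s\le h-1$. Then $p(K(n))=(\alpha^1-1,\ \alpha^1+\alpha^2-9,\ \alpha^2+\alpha^3-9,\ \dots,\ \alpha^{h-1}+\alpha^h-9)$.
   Context: A $w$-digit number is a string of $w$ decimal digits (leading zeros allowed); $A_w$ is the set of those whose digits are not all identical. For a $w$-digit number $n$, $O_d(n)=x_1\dots x_w$ is obtained by sorting its digits in non-increasing order and $O_u(n)=x_w\dots x_1$ by sorting them in non-decreasing order; the Kaprekar map is $K(n)=O_d(n)-O_u(n)$, written as a $w$-digit string with leading zeros. With $h=\lfloor w/2\rfloor$, the parameters of a $w$-digit number $n$ are $p(n)=(\alpha^1,\dots,\alpha^h)$, $\alpha^s=x_s-x_{w-s+1}$ where $x_1\ge\dots\ge x_w$ are its sorted digits. -}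

module Defs where

open import Data.Nat using (ℕ; zero; suc; _+_; _*_; _∸_; _^_; _≤ᵇ_)
open import Data.Nat.DivMod using (_/_; _%_; m%n<n)
open import Data.Nat.Properties using (m^n≢0)
open import Data.Fin using (Fin; toℕ; fromℕ<)
open import Data.Vec using (Vec; []; _∷_; reverse; toList; foldl)
open import Data.List using (List; []; _∷_)
open import Data.Bool using (if_then_else_)
open import Data.Product using (∃₂; _×_)
open import Relation.Binary.PropositionalEquality using (_≡_; _≢_)

-- A w-digit number is a vector of w decimal digits, most significant first
-- (leading zeros allowed).
Number : ℕ → Set
Number w = Vec (Fin 10) w

InA : ∀ {w} → Number w → Set
InA {w} n = ∃₂ λ (i j : Fin w) → Data.Vec.lookup n i ≢ Data.Vec.lookup n j

value : ∀ {w} → Number w → ℕ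
value = foldl (λ _ → ℕ) (λ acc d → acc * 10 + toℕ d) 0

-- the w-digit string (with leading zeros) of m mod 10^w,
-- most significant digit first
digitsOf : (w : ℕ) → ℕ → Number w
digitsOf zero    m = []
digitsOf (suc w) m =
  fromℕ< (m%n<n (_/_ m (10 ^ w) {{m^n≢0 10 w}}) 10) ∷ digitsOf w m

insertDesc : ∀ {k} → Fin 10 → Vec (Fin 10) k → Vec (Fin 10) (suc k)
insertDesc d [] = d ∷ []
insertDesc d (e ∷ es) =
  if toℕ e ≤ᵇ toℕ d then d ∷ e ∷ es else e ∷ insertDesc d es

Od : ∀ {w} → Number w → Number w
Od [] = []
Od (d ∷ ds) = insertDesc d (Od ds)

Ou : ∀ {w} → Number w → Number w
Ou n = reverse (Od n)

K : ∀ {w} → Number w → Number w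
K {w} n = digitsOf w (value (Od n) ∸ value (Ou n))

nth : List (Fin 10) → ℕ → ℕ
nth [] _ = 0
nth (d ∷ ds) zero = toℕ d
nth (d ∷ ds) (suc k) = nth ds k

x : ∀ {w} → Number w → ℕ → ℕ
x n i = nth (toList (Od n)) (i ∸ 1)

-- parameter α^s(n) = x_s - x_{w-s+1}, meaningful for 1 ≤ s ≤ ⌊w/2⌋
α : ∀ {w} → Number w → ℕ → ℕ
α {w} n s = x n s ∸ x n (w ∸ s + 1)

-- Write the sorted digits of n as nested pairs x¹ … xʰ m yʰ … y¹, so that αˢ = xˢ − yˢ. In the
-- schoolbook subtraction O_d(n) − O_u(n) exactly the columns from the middle one rightwards borrow,
-- which gives
--   K(n) = α¹ α² … αʰ⁻¹ (αʰ − 1) 9 (9 − αʰ) … (9 − α²) (10 − α¹).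
-- The αˢ are non-increasing because the digits are sorted. If moreover α¹ > α² and αˢ ≥ 5 for s ≥ 2,
-- these digits rearranged non-increasingly read
--   9 α¹ α² … αʰ⁻¹ (αʰ − 1) (9 − αʰ) … (9 − α²) (10 − α¹),
-- and since a list has only one non-increasing arrangement this is O_d(K(n)); pairing its s-th
-- digit with its (w − s + 1)-th gives the claimed parameters.
module Submission where

open import Defs
open import Data.Nat using (ℕ; zero; suc; _+_; _*_; _∸_; _^_; _≤_; _<_; _≥_; _≤ᵇ_; s≤s; s≤s⁻¹; z≤n)
open import Data.Nat.Properties
open import Data.Nat.DivMod using (_/_; _%_; +-distrib-/-∣ˡ; m*n/n≡m; [m+kn]%n≡m%n; m<n⇒m/n≡0; m<n⇒m%n≡m)
open import Data.Nat.Divisibility using (divides)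
open import Data.Nat.Tactic.RingSolver using (solve-∀)
open import Data.Bool using (true; false)
open import Data.Fin using (Fin; toℕ)
open import Data.Fin.Properties using (toℕ<n; toℕ-fromℕ<)
open import Data.Vec using (Vec; []; _∷_; toList; foldl)
open import Data.Vec.Properties using (length-toList; toList-reverse)
open import Data.List using (List; []; _∷_; _++_; [_]; length; map; reverse; initLast; _∷ʳ′_)
open import Data.List.Properties using (length-++; length-map; unfold-reverse; reverse-++; reverse-map)
open import Data.Product using (_×_; _,_; proj₁; proj₂; ∃₂; uncurry; swap)
open import Data.List.Relation.Unary.All using (All; []; _∷_)
import Data.List.Relation.Unary.All as All
import Data.List.Relation.Unary.All.Properties as Allₚ
open import Data.List.Relation.Unary.AllPairs using (AllPairs; []; _∷_)
import Data.List.Relation.Unary.AllPairs.Properties as AllPairs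
open import Data.List.Relation.Unary.Linked as Linked using (Linked; []; [-]; _∷_)
open import Data.List.Relation.Unary.Linked.Properties using (AllPairs⇒Linked)
open import Data.List.Relation.Unary.Sorted.TotalOrder.Properties using (↗↭↗⇒≋)
open import Data.List.Relation.Binary.Pointwise using (Pointwise-≡⇒≡)
open import Data.List.Relation.Binary.Permutation.Propositional using (_↭_; prep; ↭-refl; ↭-trans; ↭-sym; ↭⇒↭ₛ)
open import Data.List.Relation.Binary.Permutation.Propositional.Properties using (All-resp-↭; ++⁺ʳ)
open import Relation.Binary.Properties.TotalOrder ≤-totalOrder using (≥-totalOrder)
open import Relation.Nullary.Reflects using (ofʸ; ofⁿ)
open import Relation.Binary.PropositionalEquality hiding ([_])

digits : ∀ {k} → Vec (Fin 10) k → List ℕ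
digits v = map toℕ (toList v)

length-digits : ∀ {k} (v : Vec (Fin 10) k) → length (digits v) ≡ k
length-digits v = trans (length-map toℕ (toList v)) (length-toList v)

descending-unique : ∀ {xs ys : List ℕ} →
  AllPairs _≥_ xs → AllPairs _≥_ ys → xs ↭ ys → xs ≡ ys
descending-unique xs↘ ys↘ xs↭ys =
  Pointwise-≡⇒≡ (↗↭↗⇒≋ ≥-totalOrder (AllPairs⇒Linked xs↘) (AllPairs⇒Linked ys↘) (↭⇒↭ₛ xs↭ys))

insertDesc-↭ : ∀ {k} d (es : Vec (Fin 10) k) → digits (insertDesc d es) ↭ toℕ d ∷ digits es
insertDesc-↭ d [] = ↭-refl
insertDesc-↭ d (e ∷ es) with toℕ e ≤ᵇ toℕ d
... | true  = ↭-refl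
... | false =
  ↭-trans (prep (toℕ e) (insertDesc-↭ d es)) (_↭_.swap (toℕ e) (toℕ d) ↭-refl)

insertDesc-descending : ∀ {k} d (es : Vec (Fin 10) k) →
  AllPairs _≥_ (digits es) → AllPairs _≥_ (digits (insertDesc d es))
insertDesc-descending d [] [] = [] ∷ []
insertDesc-descending d (e ∷ es) (e≥es ∷ es↘) with toℕ e ≤ᵇ toℕ d | ≤ᵇ-reflects-≤ (toℕ e) (toℕ d)
... | true  | ofʸ e≤d = (e≤d ∷ All.map (λ e≥x → ≤-trans e≥x e≤d) e≥es) ∷ e≥es ∷ es↘
... | false | ofⁿ e≰d =
  All-resp-↭ (↭-sym (insertDesc-↭ d es)) (≰⇒≥ e≰d ∷ e≥es) ∷ insertDesc-descending d es es↘

Od-↭ : ∀ {k} (v : Vec (Fin 10) k) → digits (Od v) ↭ digits v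
Od-↭ [] = ↭-refl
Od-↭ (d ∷ ds) = ↭-trans (insertDesc-↭ d (Od ds)) (prep (toℕ d) (Od-↭ ds))

Od-descending : ∀ {k} (v : Vec (Fin 10) k) → AllPairs _≥_ (digits (Od v))
Od-descending [] = []
Od-descending (d ∷ ds) = insertDesc-descending d (Od ds) (Od-descending ds)

Od-unique : ∀ {k} (v : Vec (Fin 10) k) {L} → AllPairs _≥_ L → digits v ↭ L → digits (Od v) ≡ L
Od-unique v L↘ v↭L = descending-unique (Od-descending v) L↘ (↭-trans (Od-↭ v) v↭L)

-- Nested pairs and parameters

enclose : ℕ → List ℕ → ℕ → List ℕ
enclose a M b = a ∷ (M ++ [ b ])

-- nest ((x¹ , y¹) ∷ … ∷ (xʰ , yʰ) ∷ []) m = x¹ … xʰ m yʰ … y¹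
nest : List (ℕ × ℕ) → ℕ → List ℕ
nest []             m = [ m ]
nest ((x , y) ∷ ps) m = enclose x (nest ps m) y

gaps : List (ℕ × ℕ) → List ℕ
gaps = map (uncurry _∸_)

nthℕ : List ℕ → ℕ → ℕ
nthℕ []       _       = 0
nthℕ (d ∷ ds) zero    = d
nthℕ (d ∷ ds) (suc k) = nthℕ ds k

-- 1-indexed like α: the s-th entry minus the s-th entry from the end.
param : List ℕ → ℕ → ℕ
param L s = nthℕ L (s ∸ 1) ∸ nthℕ L (length L ∸ s)

length-∷ʳ : ∀ (M : List ℕ) b → length (M ++ [ b ]) ≡ suc (length M)
length-∷ʳ M b = trans (length-++ M) (+-comm (length M) 1)

nthℕ-++ˡ : ∀ M N i → i < length M → nthℕ (M ++ N) i ≡ nthℕ M i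
nthℕ-++ˡ (d ∷ M) N zero    _         = refl
nthℕ-++ˡ (d ∷ M) N (suc i) (s≤s i<M) = nthℕ-++ˡ M N i i<M

nthℕ-∷ʳ : ∀ M b → nthℕ (M ++ [ b ]) (length M) ≡ b
nthℕ-∷ʳ []      b = refl
nthℕ-∷ʳ (d ∷ M) b = nthℕ-∷ʳ M b

param-enclose-one : ∀ a M b → param (enclose a M b) 1 ≡ a ∸ b
param-enclose-one a M b rewrite length-∷ʳ M b = cong (a ∸_) (nthℕ-∷ʳ M b)

param-enclose-suc : ∀ a M b s → s < length M → param (enclose a M b) (suc (suc s)) ≡ param M (suc s)
param-enclose-suc a M b s s<M
  rewrite length-∷ʳ M b | +-∸-assoc 1 s<M
        | nthℕ-++ˡ M [ b ] s s<M | nthℕ-++ˡ M [ b ] (length M ∸ suc s) (∸-monoʳ-< (s≤s z≤n) s<M) = refl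

length-enclose : ∀ a M b → length (enclose a M b) ≡ 2 + length M
length-enclose a M b = cong suc (length-∷ʳ M b)

<-odd : ∀ {s n} → s < n → s < suc (2 * n)
<-odd {n = n} s<n = ≤-trans s<n (≤-trans (m≤m+n n (n + 0)) (n≤1+n _))

length-nest : ∀ ps m → length (nest ps m) ≡ suc (2 * length ps)
length-nest []             m = refl
length-nest ((x , y) ∷ ps) m =
  trans (length-enclose x (nest ps m) y)
        (trans (cong (2 +_) (length-nest ps m)) (cong suc (sym (*-suc 2 (length ps)))))

param-nest : ∀ ps m s → s < length ps → param (nest ps m) (suc s) ≡ nthℕ (gaps ps) s
param-nest ((x , y) ∷ ps) m zero    _ = param-enclose-one x (nest ps m) y
param-nest ((x , y) ∷ ps) m (suc s) (s≤s s<ps) =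
  trans (param-enclose-suc x (nest ps m) y s s<nest) (param-nest ps m s s<ps)
  where
  s<nest : s < length (nest ps m)
  s<nest = subst (s <_) (sym (length-nest ps m)) (<-odd s<ps)

odd-length⇒nest : ∀ h (L : List ℕ) → length L ≡ suc (2 * h) → ∃₂ λ ps m → length ps ≡ h × L ≡ nest ps m
odd-length⇒nest zero    (m ∷ []) _ = [] , m , refl , refl
odd-length⇒nest (suc h) (x ∷ L) |L| with initLast L
... | [] with () ← |L|
... | M ∷ʳ′ y with odd-length⇒nest h M |M|
  where
  |M| : length M ≡ suc (2 * h)
  |M| = suc-injective (begin
    suc (length M)          ≡⟨ length-∷ʳ M y ⟨
    length (M ++ [ y ])     ≡⟨ suc-injective |L| ⟩
    suc h + (suc h + 0)     ≡⟨ cong suc (+-suc h (h + 0)) ⟩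
    suc (suc (2 * h))       ∎)
    where open ≡-Reasoning
...   | ps , m , |ps| , M≡ = (x , y) ∷ ps , m , cong suc |ps| , cong (λ N → enclose x N y) M≡

reverse-enclose : ∀ a M b → reverse (enclose a M b) ≡ enclose b (reverse M) a
reverse-enclose a M b = trans (unfold-reverse a (M ++ [ b ])) (cong (_++ [ a ]) (reverse-++ M [ b ]))

reverse-nest : ∀ ps m → reverse (nest ps m) ≡ nest (map swap ps) m
reverse-nest []             m = refl
reverse-nest ((x , y) ∷ ps) m =
  trans (reverse-enclose x (nest ps m) y) (cong (λ N → enclose y N x) (reverse-nest ps m))

nth-digits : ∀ (l : List (Fin 10)) i → nth l i ≡ nthℕ (map toℕ l) i
nth-digits []      i       = refl
nth-digits (d ∷ l) zero    = refl
nth-digits (d ∷ l) (suc i) = nth-digits l i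

α-param : ∀ {w} (n : Number w) s → α n s ≡ param (digits (Od n)) s
α-param {w} n s
  rewrite nth-digits (toList (Od n)) (s ∸ 1) | nth-digits (toList (Od n)) (w ∸ s + 1 ∸ 1)
        | m+n∸n≡m (w ∸ s) 1 | length-digits (Od n) = refl

α-nest : ∀ {w} (n : Number w) ps m → digits (Od n) ≡ nest ps m →
  ∀ s → s < length ps → α n (suc s) ≡ nthℕ (gaps ps) s
α-nest n ps m Od≡ s s<ps =
  trans (α-param n (suc s)) (trans (cong (λ L → param L (suc s)) Od≡) (param-nest ps m s s<ps))

nth-≤9 : ∀ (l : List (Fin 10)) i → nth l i ≤ 9
nth-≤9 []      i       = z≤n
nth-≤9 (d ∷ l) zero    = s≤s⁻¹ (toℕ<n d)
nth-≤9 (d ∷ l) (suc i) = nth-≤9 l i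

α-≤9 : ∀ {w} (n : Number w) s → α n s ≤ 9
α-≤9 {w} n s = ≤-trans (m∸n≤m _ (x n (w ∸ s + 1))) (nth-≤9 (toList (Od n)) (s ∸ 1))

All-nthℕ⁺ : ∀ {P : ℕ → Set} l → (∀ i → i < length l → P (nthℕ l i)) → All P l
All-nthℕ⁺ []      _ = []
All-nthℕ⁺ (a ∷ l) f = f 0 (s≤s z≤n) ∷ All-nthℕ⁺ l (λ i i<l → f (suc i) (s≤s i<l))

allPairs-++⁻ : ∀ {A : Set} {R : A → A → Set} xs {ys} →
  AllPairs R (xs ++ ys) → AllPairs R xs × All (λ x → All (R x) ys) xs
allPairs-++⁻ []       _            = [] , []
allPairs-++⁻ (x ∷ xs) (x~ ∷ xs++ys↘) with allPairs-++⁻ xs xs++ys↘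
... | xs↘ , xs~ys = Allₚ.++⁻ˡ xs x~ ∷ xs↘ , Allₚ.++⁻ʳ xs x~ ∷ xs~ys

enclose-descending : ∀ {a M b} → a ≥ b → All (a ≥_) M → All (_≥ b) M → AllPairs _≥_ M →
  AllPairs _≥_ (enclose a M b)
enclose-descending a≥b a≥M M≥b M↘ =
  Allₚ.∷ʳ⁺ a≥M a≥b ∷ AllPairs.++⁺ M↘ ([] ∷ []) (All.map (_∷ []) M≥b)

enclose-descending⁻ : ∀ a M b → AllPairs _≥_ (enclose a M b) →
  All (a ≥_) M × All (_≥ b) M × AllPairs _≥_ M
enclose-descending⁻ a M b (a≥ ∷ M++b↘) with allPairs-++⁻ M M++b↘
... | M↘ , M≥b = Allₚ.++⁻ˡ M a≥ , All.map (λ { (z≥b ∷ []) → z≥b }) M≥b , M↘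

gaps-antitone : ∀ ps m → AllPairs _≥_ (nest ps m) → Linked _≥_ (gaps ps)
gaps-antitone []                                 m _  = []
gaps-antitone (_ ∷ [])                           m _  = [-]
gaps-antitone ((x , y) ∷ qs@((x′ , y′) ∷ ps)) m D↘ =
  let x≥N , N≥y , N↘ = enclose-descending⁻ x (nest qs m) y D↘
  in ∸-mono (All.head x≥N) (All.head (Allₚ.++⁻ʳ (nest ps m) (All.tail N≥y))) ∷ gaps-antitone qs m N↘

-- The subtraction O_d(n) − O_u(n)

decimal : List ℕ → ℕ
decimal []       = 0
decimal (d ∷ ds) = d * 10 ^ length ds + decimal ds

decimal-∷ʳ : ∀ M b → decimal (M ++ [ b ]) ≡ 10 * decimal M + b
decimal-∷ʳ []      b = trans (+-identityʳ (b * 1)) (*-identityʳ b)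
decimal-∷ʳ (d ∷ M) b rewrite length-∷ʳ M b | decimal-∷ʳ M b = shift d (10 ^ length M) (decimal M) b
  where
  shift : ∀ d P v b → d * (10 * P) + (10 * v + b) ≡ 10 * (d * P + v) + b
  shift = solve-∀

decimal-enclose : ∀ a M b → decimal (enclose a M b) ≡ a * 10 ^ suc (length M) + 10 * decimal M + b
decimal-enclose a M b rewrite length-∷ʳ M b | decimal-∷ʳ M b =
  sym (+-assoc (a * 10 ^ suc (length M)) (10 * decimal M) b)

foldl-decimal : ∀ {k} (v : Vec (Fin 10) k) acc →
  foldl (λ _ → ℕ) (λ acc d → acc * 10 + toℕ d) acc v ≡ acc * 10 ^ k + decimal (digits v)
foldl-decimal []              acc = sym (trans (+-identityʳ (acc * 1)) (*-identityʳ acc))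
foldl-decimal {suc k} (d ∷ v) acc rewrite foldl-decimal v (acc * 10 + toℕ d) | length-digits v =
  horner acc (toℕ d) (10 ^ k) (decimal (digits v))
  where
  horner : ∀ a d P r → (a * 10 + d) * P + r ≡ a * (10 * P) + (d * P + r)
  horner = solve-∀

value-decimal : ∀ {k} (v : Vec (Fin 10) k) → value v ≡ decimal (digits v)
value-decimal v = foldl-decimal v 0

-- One shell of the subtraction (x B y) − (y R x) − e. The last hypothesis says that E spells
-- B − R − 1 + g·10^|B|, i.e. g = 1 exactly when the inner subtraction borrows from this shell.
decimal-enclose-sub : ∀ {g a c e x y} E R B → y + (g + a) ≡ x → c + (g + a) + e ≡ 10 →
  length E ≡ length B → length R ≡ length B →
  decimal E + 1 + decimal R ≡ g * 10 ^ length B + decimal B →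
  decimal (enclose a E c) + e + decimal (enclose y R x) ≡ decimal (enclose x B y)
decimal-enclose-sub {g} {a} {c} {e} {y = y} E R B refl digit-sum |E| |R| inner
  rewrite decimal-enclose a E c | decimal-enclose y R (y + (g + a))
        | decimal-enclose (y + (g + a)) B y | |E| | |R| = begin
  a * (10 * P) + 10 * dE + c + e + (y * (10 * P) + 10 * dR + (y + (g + a)))
    ≡⟨ collect P g a c e y dE dR ⟩
  (y + a) * (10 * P) + 10 * (dE + dR) + y + (c + (g + a) + e)
    ≡⟨ cong ((y + a) * (10 * P) + 10 * (dE + dR) + y +_) digit-sum ⟩
  (y + a) * (10 * P) + 10 * (dE + dR) + y + 10
    ≡⟨ carry P a y dE dR ⟩
  (y + a) * (10 * P) + 10 * (dE + 1 + dR) + y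
    ≡⟨ cong (λ z → (y + a) * (10 * P) + 10 * z + y) inner ⟩
  (y + a) * (10 * P) + 10 * (g * P + decimal B) + y
    ≡⟨ borrow P g a y (decimal B) ⟩
  (y + (g + a)) * (10 * P) + 10 * decimal B + y ∎
  where
  open ≡-Reasoning
  P dE dR : ℕ
  P = 10 ^ length B
  dE = decimal E
  dR = decimal R
  collect : ∀ P g a c e y E R →
    a * (10 * P) + 10 * E + c + e + (y * (10 * P) + 10 * R + (y + (g + a)))
      ≡ (y + a) * (10 * P) + 10 * (E + R) + y + (c + (g + a) + e)
  collect = solve-∀
  carry : ∀ P a y E R →
    (y + a) * (10 * P) + 10 * (E + R) + y + 10 ≡ (y + a) * (10 * P) + 10 * (E + 1 + R) + y
  carry = solve-∀
  borrow : ∀ P g a y B →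
    (y + a) * (10 * P) + 10 * (g * P + B) + y ≡ (y + (g + a)) * (10 * P) + 10 * B + y
  borrow = solve-∀

borrowDigits : ℕ → List ℕ → List ℕ
borrowDigits a []       = enclose (a ∸ 1) [ 9 ] (9 ∸ a)
borrowDigits a (b ∷ bs) = enclose a (borrowDigits b bs) (9 ∸ a)

kaprekarDigits : ℕ → ℕ → List ℕ → List ℕ
kaprekarDigits a b bs = enclose a (borrowDigits b bs) (10 ∸ a)

length-borrowDigits : ∀ a bs → length (borrowDigits a bs) ≡ suc (2 * suc (length bs))
length-borrowDigits a []       = refl
length-borrowDigits a (b ∷ bs) =
  trans (length-enclose a (borrowDigits b bs) (9 ∸ a))
        (trans (cong (2 +_) (length-borrowDigits b bs)) (cong suc (sym (*-suc 2 (suc (length bs))))))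

length-borrowDigits-gaps : ∀ a p ps m → length (borrowDigits a (gaps ps)) ≡ length (nest (p ∷ ps) m)
length-borrowDigits-gaps a p ps m =
  trans (length-borrowDigits a (gaps ps))
        (trans (cong (λ k → suc (2 * suc k)) (length-map _ ps)) (sym (length-nest (p ∷ ps) m)))

length-nest-swap : ∀ ps m → length (nest (map swap ps) m) ≡ length (nest ps m)
length-nest-swap ps m =
  trans (length-nest (map swap ps) m)
        (trans (cong (λ k → suc (2 * k)) (length-map swap ps)) (sym (length-nest ps m)))

Gap : ℕ × ℕ → Set
Gap (x , y) = y < x × x ≤ 9

gap-+ : ∀ {x y} → Gap (x , y) → y + (x ∸ y) ≡ x
gap-+ (y<x , _) = m+[n∸m]≡n (<⇒≤ y<x)

gap-≤9 : ∀ {x y} → Gap (x , y) → x ∸ y ≤ 9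
gap-≤9 {x} {y} (_ , x≤9) = ≤-trans (m∸n≤m x y) x≤9

decimal-borrowDigits : ∀ x y ps m → All Gap ((x , y) ∷ ps) →
  decimal (borrowDigits (x ∸ y) (gaps ps)) + 1 + decimal (nest (map swap ((x , y) ∷ ps)) m)
    ≡ decimal (nest ((x , y) ∷ ps) m)
-- The middle column m − m − 1 borrows, hence g = 1 for the innermost shell.
decimal-borrowDigits x y [] m (gap@(y<x , _) ∷ []) =
  decimal-enclose-sub {g = 1} {a = x ∸ y ∸ 1} {c = 9 ∸ (x ∸ y)} {e = 1} [ 9 ] [ m ] [ m ]
    top digit-sum refl refl refl
  where
  1+a-1≡a : 1 + (x ∸ y ∸ 1) ≡ x ∸ y
  1+a-1≡a = m+[n∸m]≡n (m<n⇒0<n∸m y<x)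
  top : y + (1 + (x ∸ y ∸ 1)) ≡ x
  top = trans (cong (y +_) 1+a-1≡a) (gap-+ gap)
  digit-sum : 9 ∸ (x ∸ y) + (1 + (x ∸ y ∸ 1)) + 1 ≡ 10
  digit-sum = trans (cong (λ z → 9 ∸ (x ∸ y) + z + 1) 1+a-1≡a)
                    (cong (_+ 1) (m∸n+n≡m (gap-≤9 gap)))
decimal-borrowDigits x y ((x′ , y′) ∷ ps) m (gap ∷ gaps′) =
  decimal-enclose-sub {g = 0} {a = x ∸ y} {c = 9 ∸ (x ∸ y)} {e = 1}
    (borrowDigits (x′ ∸ y′) (gaps ps)) (nest (map swap ((x′ , y′) ∷ ps)) m) (nest ((x′ , y′) ∷ ps) m)
    (gap-+ gap) (cong (_+ 1) (m∸n+n≡m (gap-≤9 gap)))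
    (length-borrowDigits-gaps (x′ ∸ y′) (x′ , y′) ps m) (length-nest-swap ((x′ , y′) ∷ ps) m)
    (decimal-borrowDigits x′ y′ ps m gaps′)

decimal-kaprekarDigits : ∀ x y x′ y′ ps m → All Gap ((x , y) ∷ (x′ , y′) ∷ ps) →
  decimal (kaprekarDigits (x ∸ y) (x′ ∸ y′) (gaps ps))
    + decimal (reverse (nest ((x , y) ∷ (x′ , y′) ∷ ps) m))
    ≡ decimal (nest ((x , y) ∷ (x′ , y′) ∷ ps) m)
decimal-kaprekarDigits x y x′ y′ ps m (gap ∷ gaps′) = begin
  decimal Kd + decimal (reverse D)     ≡⟨ cong (λ L → decimal Kd + decimal L) (reverse-nest qs m) ⟩
  decimal Kd + decimal R               ≡⟨ cong (_+ decimal R) (+-identityʳ (decimal Kd)) ⟨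
  decimal Kd + 0 + decimal R
    ≡⟨ decimal-enclose-sub {g = 0} {a = x ∸ y} {c = 10 ∸ (x ∸ y)} {e = 0} E R′ B (gap-+ gap) digit-sum
         (length-borrowDigits-gaps (x′ ∸ y′) (x′ , y′) ps m) (length-nest-swap ((x′ , y′) ∷ ps) m)
         (decimal-borrowDigits x′ y′ ps m gaps′) ⟩
  decimal D                            ∎
  where
  open ≡-Reasoning
  qs : List (ℕ × ℕ)
  qs = (x , y) ∷ (x′ , y′) ∷ ps
  D Kd R E R′ B : List ℕ
  D = nest qs m
  Kd = kaprekarDigits (x ∸ y) (x′ ∸ y′) (gaps ps)
  R = nest (map swap qs) m
  E = borrowDigits (x′ ∸ y′) (gaps ps)
  R′ = nest (map swap ((x′ , y′) ∷ ps)) m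
  B = nest ((x′ , y′) ∷ ps) m
  digit-sum : 10 ∸ (x ∸ y) + (x ∸ y) + 0 ≡ 10
  digit-sum = trans (+-identityʳ _) (m∸n+n≡m (m≤n⇒m≤1+n (gap-≤9 gap)))

infixl 7 _/10^_
_/10^_ : ℕ → ℕ → ℕ
m /10^ k = _/_ m (10 ^ k) {{m^n≢0 10 k}}

digitsℕ : ℕ → ℕ → List ℕ
digitsℕ zero    m = []
digitsℕ (suc w) m = m /10^ w % 10 ∷ digitsℕ w m

digits-digitsOf : ∀ w m → digits (digitsOf w m) ≡ digitsℕ w m
digits-digitsOf zero    m = refl
digits-digitsOf (suc w) m = cong₂ _∷_ (toℕ-fromℕ< _) (digits-digitsOf w m)

/10^-shift : ∀ c r k → (c * 10 ^ k + r) /10^ k ≡ c + r /10^ k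
/10^-shift c r k = trans (+-distrib-/-∣ˡ r {{m^n≢0 10 k}} (divides c refl))
                         (cong (_+ r /10^ k) (m*n/n≡m c (10 ^ k) {{m^n≢0 10 k}}))

digitsℕ-shift : ∀ k c r → digitsℕ k (c * 10 ^ k + r) ≡ digitsℕ k r
digitsℕ-shift zero    c r = refl
digitsℕ-shift (suc k) c r =
  cong₂ _∷_ leading (trans (cong (digitsℕ k) reassoc) (digitsℕ-shift k (c * 10) r))
  where
  reassoc : c * 10 ^ suc k + r ≡ c * 10 * 10 ^ k + r
  reassoc = cong (_+ r) (sym (*-assoc c 10 (10 ^ k)))
  leading : (c * 10 ^ suc k + r) /10^ k % 10 ≡ r /10^ k % 10
  leading = begin
    (c * 10 ^ suc k + r) /10^ k % 10 ≡⟨ cong (λ z → z /10^ k % 10) reassoc ⟩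
    (c * 10 * 10 ^ k + r) /10^ k % 10 ≡⟨ cong (_% 10) (/10^-shift (c * 10) r k) ⟩
    (c * 10 + r /10^ k) % 10          ≡⟨ cong (_% 10) (+-comm (c * 10) (r /10^ k)) ⟩
    (r /10^ k + c * 10) % 10          ≡⟨ [m+kn]%n≡m%n (r /10^ k) c 10 ⟩
    r /10^ k % 10                     ∎
    where open ≡-Reasoning

decimal-< : ∀ E → All (_< 10) E → decimal E < 10 ^ length E
decimal-< []      []          = s≤s z≤n
decimal-< (d ∷ E) (d<10 ∷ E<10) = begin-strict
  d * 10 ^ length E + decimal E     <⟨ +-monoʳ-< (d * 10 ^ length E) (decimal-< E E<10) ⟩
  d * 10 ^ length E + 10 ^ length E ≡⟨ +-comm (d * 10 ^ length E) (10 ^ length E) ⟩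
  suc d * 10 ^ length E             ≤⟨ *-monoˡ-≤ (10 ^ length E) d<10 ⟩
  10 ^ suc (length E)               ∎
  where open ≤-Reasoning

digitsℕ-decimal : ∀ E → All (_< 10) E → digitsℕ (length E) (decimal E) ≡ E
digitsℕ-decimal []      []            = refl
digitsℕ-decimal (d ∷ E) (d<10 ∷ E<10) =
  cong₂ _∷_ leading (trans (digitsℕ-shift (length E) d (decimal E)) (digitsℕ-decimal E E<10))
  where
  leading : (d * 10 ^ length E + decimal E) /10^ length E % 10 ≡ d
  leading = begin
    (d * 10 ^ length E + decimal E) /10^ length E % 10
      ≡⟨ cong (_% 10) (/10^-shift d (decimal E) (length E)) ⟩
    (d + decimal E /10^ length E) % 10
      ≡⟨ cong (λ z → (d + z) % 10) (m<n⇒m/n≡0 {{m^n≢0 10 (length E)}} (decimal-< E E<10)) ⟩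
    (d + 0) % 10
      ≡⟨ cong (_% 10) (+-identityʳ d) ⟩
    d % 10
      ≡⟨ m<n⇒m%n≡m d<10 ⟩
    d ∎
    where open ≡-Reasoning

-- The non-increasing rearrangement of K(n)

sortedCore : ℕ → List ℕ → List ℕ
sortedCore a []       = [ a ∸ 1 ]
sortedCore a (b ∷ bs) = enclose a (sortedCore b bs) (9 ∸ b)

sortedKaprekarDigits : ℕ → List ℕ → List ℕ
sortedKaprekarDigits a bs = enclose 9 (sortedCore a bs) (10 ∸ a)

sortedCore-↭ : ∀ a b bs → 9 ∷ sortedCore a (b ∷ bs) ↭ a ∷ borrowDigits b bs
sortedCore-↭ a b []       = ↭-trans (_↭_.swap 9 a ↭-refl) (prep a (_↭_.swap 9 (b ∸ 1) ↭-refl))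
sortedCore-↭ a b (c ∷ cs) = ↭-trans (_↭_.swap 9 a ↭-refl) (prep a (++⁺ʳ [ 9 ∸ b ] (sortedCore-↭ b c cs)))

kaprekarDigits-↭ : ∀ a b bs → kaprekarDigits a b bs ↭ sortedKaprekarDigits a (b ∷ bs)
kaprekarDigits-↭ a b bs = ↭-sym (++⁺ʳ [ 10 ∸ a ] (sortedCore-↭ a b bs))

9∸-≤ : ∀ {u v} → 5 ≤ u → 4 ≤ v → 9 ∸ u ≤ v
9∸-≤ 5≤u 4≤v = ≤-trans (∸-monoʳ-≤ 9 5≤u) 4≤v

sortedCore-bounds : ∀ b bs → All (5 ≤_) (b ∷ bs) → Linked _≥_ (b ∷ bs) →
  All (λ z → 9 ∸ b ≤ z × z ≤ b) (sortedCore b bs)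
sortedCore-bounds b []       (5≤b ∷ []) _ = (9∸-≤ 5≤b (∸-monoˡ-≤ 1 5≤b) , m∸n≤m b 1) ∷ []
sortedCore-bounds b (c ∷ cs) (5≤b ∷ 5≤c∷cs@(5≤c ∷ _)) (c≤b ∷ c∷cs↘) =
  (9∸-≤ 5≤b 4≤b , ≤-refl)
    ∷ Allₚ.∷ʳ⁺ (All.map widen (sortedCore-bounds c cs 5≤c∷cs c∷cs↘)) (9∸b≤9∸c , 9∸-≤ 5≤c 4≤b)
  where
  4≤b : 4 ≤ b
  4≤b = ≤-trans (n≤1+n 4) 5≤b
  9∸b≤9∸c : 9 ∸ b ≤ 9 ∸ c
  9∸b≤9∸c = ∸-monoʳ-≤ 9 c≤b
  widen : ∀ {z} → 9 ∸ c ≤ z × z ≤ c → 9 ∸ b ≤ z × z ≤ b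
  widen (lo , hi) = ≤-trans 9∸b≤9∸c lo , ≤-trans hi c≤b

sortedCore-descending : ∀ b bs → All (5 ≤_) (b ∷ bs) → Linked _≥_ (b ∷ bs) →
  AllPairs _≥_ (sortedCore b bs)
sortedCore-descending b []       _ _ = [] ∷ []
sortedCore-descending b (c ∷ cs) (5≤b ∷ 5≤c∷cs@(5≤c ∷ _)) (c≤b ∷ c∷cs↘) =
  enclose-descending (9∸-≤ 5≤c (≤-trans (n≤1+n 4) 5≤b))
    (All.map (λ bounds → ≤-trans (proj₂ bounds) c≤b) core-bounds) (All.map proj₁ core-bounds)
    (sortedCore-descending c cs 5≤c∷cs c∷cs↘)
  where
  core-bounds : All (λ z → 9 ∸ c ≤ z × z ≤ c) (sortedCore c cs)
  core-bounds = sortedCore-bounds c cs 5≤c∷cs c∷cs↘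

sortedKaprekarDigits-descending : ∀ a b bs → a ≤ 9 → b < a → All (5 ≤_) (b ∷ bs) → Linked _≥_ (b ∷ bs) →
  AllPairs _≥_ (sortedKaprekarDigits a (b ∷ bs))
sortedKaprekarDigits-descending a b bs a≤9 b<a 5≤b∷bs@(5≤b ∷ _) b∷bs↘ =
  enclose-descending (∸-monoʳ-≤ 10 (≤-trans (s≤s z≤n) 6≤a))
    (All.map (λ bounds → ≤-trans (proj₂ bounds) a≤9) (sortedCore-bounds a (b ∷ bs) 5≤a∷b∷bs a∷b∷bs↘))
    (10∸a≤a ∷ Allₚ.∷ʳ⁺ (All.map (λ bounds → ≤-trans 10∸a≤9∸b (proj₁ bounds))
                                 (sortedCore-bounds b bs 5≤b∷bs b∷bs↘))
                       10∸a≤9∸b)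
    (sortedCore-descending a (b ∷ bs) 5≤a∷b∷bs a∷b∷bs↘)
  where
  6≤a : 6 ≤ a
  6≤a = ≤-trans (s≤s 5≤b) b<a
  5≤a∷b∷bs : All (5 ≤_) (a ∷ b ∷ bs)
  5≤a∷b∷bs = ≤-trans (n≤1+n 5) 6≤a ∷ 5≤b∷bs
  a∷b∷bs↘ : Linked _≥_ (a ∷ b ∷ bs)
  a∷b∷bs↘ = <⇒≤ b<a ∷ b∷bs↘
  10∸a≤9∸b : 10 ∸ a ≤ 9 ∸ b
  10∸a≤9∸b = ∸-monoʳ-≤ 10 b<a
  10∸a≤a : 10 ∸ a ≤ a
  10∸a≤a = ≤-trans (∸-monoʳ-≤ 10 6≤a) (≤-trans (≤-trans (n≤1+n 4) (n≤1+n 5)) 6≤a)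

length-sortedCore : ∀ a bs → length (sortedCore a bs) ≡ suc (2 * length bs)
length-sortedCore a []       = refl
length-sortedCore a (b ∷ bs) =
  trans (length-enclose a (sortedCore b bs) (9 ∸ b))
        (trans (cong (2 +_) (length-sortedCore b bs)) (cong suc (sym (*-suc 2 (length bs)))))

param-sortedCore : ∀ a bs s → s < length bs →
  param (sortedCore a bs) (suc s) ≡ nthℕ (a ∷ bs) s ∸ (9 ∸ nthℕ bs s)
param-sortedCore a (b ∷ bs) zero    _          = param-enclose-one a (sortedCore b bs) (9 ∸ b)
param-sortedCore a (b ∷ bs) (suc s) (s≤s s<bs) =
  trans (param-enclose-suc a (sortedCore b bs) (9 ∸ b) s s<core) (param-sortedCore b bs s s<bs)
  where
  s<core : s < length (sortedCore b bs)
  s<core = subst (s <_) (sym (length-sortedCore b bs)) (<-odd s<bs)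

param-sortedKaprekarDigits-one : ∀ a bs → 1 ≤ a → a ≤ 10 → param (sortedKaprekarDigits a bs) 1 ≡ a ∸ 1
param-sortedKaprekarDigits-one (suc a) bs _ (s≤s a≤9) =
  trans (param-enclose-one 9 (sortedCore (suc a) bs) (9 ∸ a)) (m∸[m∸n]≡n a≤9)

param-sortedKaprekarDigits-suc : ∀ a bs s → s < length bs → nthℕ bs s ≤ 9 →
  param (sortedKaprekarDigits a bs) (suc (suc s)) ≡ nthℕ (a ∷ bs) s + nthℕ bs s ∸ 9
param-sortedKaprekarDigits-suc a bs s s<bs v≤9 = begin
  param (sortedKaprekarDigits a bs) (suc (suc s)) ≡⟨ param-enclose-suc 9 (sortedCore a bs) (10 ∸ a) s s<core ⟩
  param (sortedCore a bs) (suc s)                 ≡⟨ param-sortedCore a bs s s<bs ⟩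
  u ∸ (9 ∸ v)                                     ≡⟨ cong (_∸ (9 ∸ v)) (m+n∸n≡m u v) ⟨
  u + v ∸ v ∸ (9 ∸ v)                             ≡⟨ ∸-+-assoc (u + v) v (9 ∸ v) ⟩
  u + v ∸ (v + (9 ∸ v))                           ≡⟨ cong (u + v ∸_) (m+[n∸m]≡n v≤9) ⟩
  u + v ∸ 9                                       ∎
  where
  open ≡-Reasoning
  u v : ℕ
  u = nthℕ (a ∷ bs) s
  v = nthℕ bs s
  s<core : s < length (sortedCore a bs)
  s<core = subst (s <_) (sym (length-sortedCore a bs)) (<-odd s<bs)

digits<10 : ∀ {k} (v : Vec (Fin 10) k) → All (_< 10) (digits v)
digits<10 []      = []
digits<10 (d ∷ v) = toℕ<n d ∷ digits<10 v

digits-reverse : ∀ {k} (v : Vec (Fin 10) k) → digits (Data.Vec.reverse v) ≡ reverse (digits v)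
digits-reverse v = trans (cong (map toℕ) (toList-reverse v)) (reverse-map toℕ (toList v))

nest-gaps : ∀ ps m → All (_< 10) (nest ps m) → All (1 ≤_) (gaps ps) → All Gap ps
nest-gaps []             m _              []           = []
nest-gaps ((x , y) ∷ ps) m (x<10 ∷ N++y<10) (1≤x∸y ∷ gs) =
  (m∸n≢0⇒n<m (n>0⇒n≢0 1≤x∸y) , s≤s⁻¹ x<10) ∷ nest-gaps ps m (Allₚ.++⁻ˡ (nest ps m) N++y<10) gs

length-kaprekarDigits : ∀ x y x′ y′ ps m →
  length (kaprekarDigits (x ∸ y) (x′ ∸ y′) (gaps ps)) ≡ length (nest ((x , y) ∷ (x′ , y′) ∷ ps) m)
length-kaprekarDigits x y x′ y′ ps m =
  trans (length-enclose (x ∸ y) (borrowDigits (x′ ∸ y′) (gaps ps)) (10 ∸ (x ∸ y)))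
        (trans (cong (2 +_) (length-borrowDigits-gaps (x′ ∸ y′) (x′ , y′) ps m))
               (sym (length-enclose x (nest ((x′ , y′) ∷ ps) m) y)))

digits-K : ∀ {w} (n : Number w) x y x′ y′ ps m → digits (Od n) ≡ nest ((x , y) ∷ (x′ , y′) ∷ ps) m →
  All Gap ((x , y) ∷ (x′ , y′) ∷ ps) → All (_< 10) (kaprekarDigits (x ∸ y) (x′ ∸ y′) (gaps ps)) →
  digits (K n) ≡ kaprekarDigits (x ∸ y) (x′ ∸ y′) (gaps ps)
digits-K {w} n x y x′ y′ ps m Od≡ gaps-ok Kd<10 = begin
  digits (K n)                                     ≡⟨ digits-digitsOf w _ ⟩
  digitsℕ w (value (Od n) ∸ value (Ou n))          ≡⟨ cong₂ digitsℕ w≡ difference ⟩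
  digitsℕ (length Kd) (decimal Kd)                 ≡⟨ digitsℕ-decimal Kd Kd<10 ⟩
  Kd                                               ∎
  where
  open ≡-Reasoning
  D Kd : List ℕ
  D = nest ((x , y) ∷ (x′ , y′) ∷ ps) m
  Kd = kaprekarDigits (x ∸ y) (x′ ∸ y′) (gaps ps)
  w≡ : w ≡ length Kd
  w≡ = trans (sym (length-digits (Od n)))
             (trans (cong length Od≡) (sym (length-kaprekarDigits x y x′ y′ ps m)))
  difference : value (Od n) ∸ value (Ou n) ≡ decimal Kd
  difference = begin
    value (Od n) ∸ value (Ou n)
      ≡⟨ cong₂ _∸_ (value-decimal (Od n)) (value-decimal (Ou n)) ⟩
    decimal (digits (Od n)) ∸ decimal (digits (Ou n))
      ≡⟨ cong₂ (λ L L′ → decimal L ∸ decimal L′) Od≡ (trans (digits-reverse (Od n)) (cong reverse Od≡)) ⟩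
    decimal D ∸ decimal (reverse D)
      ≡⟨ cong (_∸ decimal (reverse D)) (decimal-kaprekarDigits x y x′ y′ ps m gaps-ok) ⟨
    decimal Kd + decimal (reverse D) ∸ decimal (reverse D)
      ≡⟨ m+n∸n≡m (decimal Kd) (decimal (reverse D)) ⟩
    decimal Kd                                     ∎

Od-K : ∀ {w} (n : Number w) x y x′ y′ ps m → digits (Od n) ≡ nest ((x , y) ∷ (x′ , y′) ∷ ps) m →
  x′ ∸ y′ < x ∸ y → All (5 ≤_) (gaps ((x′ , y′) ∷ ps)) →
  digits (Od (K n)) ≡ sortedKaprekarDigits (x ∸ y) (gaps ((x′ , y′) ∷ ps))
Od-K n x y x′ y′ ps m Od≡ b<a 5≤bs =
  Od-unique (K n) S↘ (subst (_↭ S) (sym (digits-K n x y x′ y′ ps m Od≡ gaps-ok Kd<10)) Kd↭S)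
  where
  qs : List (ℕ × ℕ)
  qs = (x , y) ∷ (x′ , y′) ∷ ps
  S : List ℕ
  S = sortedKaprekarDigits (x ∸ y) (gaps ((x′ , y′) ∷ ps))
  Kd↭S : kaprekarDigits (x ∸ y) (x′ ∸ y′) (gaps ps) ↭ S
  Kd↭S = kaprekarDigits-↭ (x ∸ y) (x′ ∸ y′) (gaps ps)
  D<10 : All (_< 10) (nest qs m)
  D<10 = subst (All (_< 10)) Od≡ (digits<10 (Od n))
  gaps-ok : All Gap qs
  gaps-ok = nest-gaps qs m D<10 (≤-trans (s≤s z≤n) b<a ∷ All.map (≤-trans (s≤s z≤n)) 5≤bs)
  S↘ : AllPairs _≥_ S
  S↘ = sortedKaprekarDigits-descending (x ∸ y) (x′ ∸ y′) (gaps ps) (gap-≤9 (All.head gaps-ok)) b<a 5≤bs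
         (Linked.tail (gaps-antitone qs m (subst (AllPairs _≥_) Od≡ (Od-descending n))))
  Kd<10 : All (_< 10) (kaprekarDigits (x ∸ y) (x′ ∸ y′) (gaps ps))
  Kd<10 with S↘
  ... | 9≥S ∷ _ = All-resp-↭ (↭-sym Kd↭S) (s≤s ≤-refl ∷ All.map s≤s 9≥S)

α-K : ∀ {w} (n : Number w) x y x′ y′ ps m → digits (Od n) ≡ nest ((x , y) ∷ (x′ , y′) ∷ ps) m →
  α n 2 < α n 1 → (∀ s → s ≤ length ps → 5 ≤ α n (2 + s)) →
  α (K n) 1 ≡ α n 1 ∸ 1 × (∀ s → s ≤ length ps → α (K n) (2 + s) ≡ α n (1 + s) + α n (2 + s) ∸ 9)
α-K n x y x′ y′ ps m Od≡ α²<α¹ 5≤α = α¹-K , αˢ-K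
  where
  bs : List ℕ
  bs = gaps ((x′ , y′) ∷ ps)
  α≡gap : ∀ s → s < 2 + length ps → α n (suc s) ≡ nthℕ (x ∸ y ∷ bs) s
  α≡gap = α-nest n ((x , y) ∷ (x′ , y′) ∷ ps) m Od≡
  |bs| : length bs ≡ suc (length ps)
  |bs| = cong suc (length-map _ ps)
  b<a : x′ ∸ y′ < x ∸ y
  b<a = subst₂ _<_ (α≡gap 1 (s≤s (s≤s z≤n))) (α≡gap 0 (s≤s z≤n)) α²<α¹
  5≤bs : All (5 ≤_) bs
  5≤bs = All-nthℕ⁺ bs λ i i<bs →
    let i≤ps = s≤s⁻¹ (subst (i <_) |bs| i<bs)
    in subst (5 ≤_) (α≡gap (suc i) (s≤s (s≤s i≤ps))) (5≤α i i≤ps)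
  αK≡ : ∀ s → α (K n) s ≡ param (sortedKaprekarDigits (x ∸ y) bs) s
  αK≡ s = trans (α-param (K n) s) (cong (λ L → param L s) (Od-K n x y x′ y′ ps m Od≡ b<a 5≤bs))
  α¹-K : α (K n) 1 ≡ α n 1 ∸ 1
  α¹-K = trans (αK≡ 1)
         (trans (param-sortedKaprekarDigits-one (x ∸ y) bs (≤-trans (s≤s z≤n) b<a) a≤10)
                (cong (_∸ 1) (sym (α≡gap 0 (s≤s z≤n)))))
    where
    a≤10 : x ∸ y ≤ 10
    a≤10 = m≤n⇒m≤1+n (subst (_≤ 9) (α≡gap 0 (s≤s z≤n)) (α-≤9 n 1))
  αˢ-K : ∀ s → s ≤ length ps → α (K n) (2 + s) ≡ α n (1 + s) + α n (2 + s) ∸ 9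
  αˢ-K s s≤ps = begin
    α (K n) (2 + s)                                 ≡⟨ αK≡ (2 + s) ⟩
    param (sortedKaprekarDigits (x ∸ y) bs) (2 + s)
      ≡⟨ param-sortedKaprekarDigits-suc (x ∸ y) bs s s<bs αˢ⁺²≤9 ⟩
    nthℕ (x ∸ y ∷ bs) s + nthℕ bs s ∸ 9
      ≡⟨ cong₂ (λ u v → u + v ∸ 9) (α≡gap s s<2+ps) (α≡gap (suc s) s+2≤2+ps) ⟨
    α n (1 + s) + α n (2 + s) ∸ 9                   ∎
    where
    open ≡-Reasoning
    s+2≤2+ps : 2 + s ≤ 2 + length ps
    s+2≤2+ps = s≤s (s≤s s≤ps)
    s<2+ps : s < 2 + length ps
    s<2+ps = ≤-trans (n≤1+n (suc s)) s+2≤2+ps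
    s<bs : s < length bs
    s<bs = subst (s <_) (sym |bs|) (s≤s s≤ps)
    αˢ⁺²≤9 : nthℕ bs s ≤ 9
    αˢ⁺²≤9 = subst (_≤ 9) (α≡gap (suc s) s+2≤2+ps) (α-≤9 n (2 + s))

-- Only α² < α¹ and 5 ≤ αˢ (s ≥ 2) are used: n ∈ A_w, 5 < α¹ and αˢ + αˢ⁺¹ ≥ 9 follow
-- from them, and αˢ ≤ 8 may be weakened to the automatic αˢ ≤ 9.
mainTheorem7 : (h : ℕ) → 2 ≤ h → (n : Number (suc (2 * h))) → InA n →
    5 < α n 1 →
    α n 2 + 1 ≤ α n 1 →
    (∀ s → 2 ≤ s → s ≤ h → 5 ≤ α n s × α n s ≤ 8) →
    (∀ s → 1 ≤ s → s ≤ h ∸ 1 → 9 ≤ α n s + α n (suc s)) →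
    α (K n) 1 ≡ α n 1 ∸ 1 ×
    (∀ s → 2 ≤ s → s ≤ h → α (K n) s ≡ α n (s ∸ 1) + α n s ∸ 9)
mainTheorem7 h 2≤h n _ _ α²<α¹ α-range _
  with odd-length⇒nest h (digits (Od n)) (length-digits (Od n))
... | []     , _ , refl , _ with () ← 2≤h
... | _ ∷ [] , _ , refl , _ with s≤s () ← 2≤h
... | (x , y) ∷ (x′ , y′) ∷ ps , m , refl , Od≡ = proj₁ K-params , αˢ-K
  where
  K-params : α (K n) 1 ≡ α n 1 ∸ 1 ×
             (∀ s → s ≤ length ps → α (K n) (2 + s) ≡ α n (1 + s) + α n (2 + s) ∸ 9)
  K-params = α-K n x y x′ y′ ps m Od≡ (subst (_≤ α n 1) (+-comm (α n 2) 1) α²<α¹)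
               (λ s s≤ps → proj₁ (α-range (2 + s) (s≤s (s≤s z≤n)) (s≤s (s≤s s≤ps))))
  αˢ-K : ∀ s → 2 ≤ s → s ≤ 2 + length ps → α (K n) s ≡ α n (s ∸ 1) + α n s ∸ 9
  αˢ-K (suc zero)    (s≤s ()) _
  αˢ-K (suc (suc s)) _        (s≤s (s≤s s≤ps)) = proj₂ K-params s s≤ps
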